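{- Let $G$ be a graph on $n$ vertices with $e(G)$ edges, let $k$ be a positive integer, and let $(A_1,\dots,A_n)$ be a reduced $k$-min-difference representation of $G$. Then \[ \Bigl|\bigcup_{i} A_i\Bigr|\le 2e(G)k\le kn^2. \]
   Context: A $k$-min-difference representation of a graph $G$ on vertex set $[n]$ is an assignment of a finite set $A_i$ to each vertex $i$ such that for distinct $i,j$: $ij\in E(G)$ iff $\min\{|A_i\setminus A_j|,|A_j\setminus A_i|\}\ge k$. Such a representation is reduced if for every element $x\in\bigcup_i A_i$, the family $(A_i\setminus\{x\}: i\in[n])$, viewed as a $k$-min-difference representation, defines a graph different from $G$. -}

module Defs where

open import Data.Nat using (ℕ; _≤_; _⊓_; _<ᵇ_; _≤ᵇ_)
open import Data.Bool using (Bool; true; false; _∧_; if_then_else_)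
open import Data.Fin using (Fin; toℕ)
open import Data.Fin.Subset using (Subset; _─_; _-_; ⋃; ∣_∣; _∈_)
open import Data.List using (List; map; allFin)
open import Data.Nat.ListAction using (sum)
open import Relation.Binary.PropositionalEquality using (_≡_; _≢_)
open import Relation.Nullary using (¬_)
open import Function.Bundles using (_⇔_)

record Graph (n : ℕ) : Set where
  field
    adj     : Fin n → Fin n → Bool
    adj-sym : ∀ i j → adj i j ≡ adj j i
    adj-irr : ∀ i → adj i i ≡ false
open Graph public

edgeCount : ∀ {n} → Graph n → ℕ
edgeCount {n} G =
  sum (map (λ i → sum (map (λ j → if (toℕ i <ᵇ toℕ j) ∧ adj G i j then 1 else 0)
                           (allFin n)))
           (allFin n))

Family : ℕ → ℕ → Set
Family n m = Fin n → Subset m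

bigUnion : ∀ {n m} → Family n m → Subset m
bigUnion {n} A = ⋃ (map A (allFin n))

minDiff : ∀ {n m} → Family n m → Fin n → Fin n → ℕ
minDiff A i j = ∣ A i ─ A j ∣ ⊓ ∣ A j ─ A i ∣

repAdj : ∀ {n m} → ℕ → Family n m → Fin n → Fin n → Bool
repAdj k A i j = k ≤ᵇ minDiff A i j

IsMinDiffRep : ∀ {n m} → ℕ → Graph n → Family n m → Set
IsMinDiffRep k G A =
  ∀ i j → i ≢ j → (adj G i j ≡ true ⇔ k ≤ minDiff A i j)

IsReduced : ∀ {n m} → ℕ → Graph n → Family n m → Set
IsReduced k G A =
  ∀ x → x ∈ bigUnion A →
    ¬ (∀ i j → i ≢ j → repAdj k (λ l → A l - x) i j ≡ adj G i j)

-- Call a set difference A i ─ A j critical if it has at most k elements.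
-- An element x lying in no critical difference of an edge can be deleted:
-- differences only shrink, so non-edges stay non-edges, and along an edge
-- each difference either avoids x or has more than k elements and still
-- has at least k after losing x.  In a reduced representation every
-- element must therefore lie in a critical difference of some edge, and
-- each edge contributes at most 2k such elements.  Finally each unordered
-- pair is counted once by e(G), so 2e(G) ≤ n².
module Submission where

open import Defs
open import Data.Nat using (ℕ; _≤_; _*_; _^_)
open import Data.Fin.Subset using (∣_∣)
open import Data.Product using (_×_)

open import Data.Bool using (Bool; true; false; _∧_; if_then_else_)
open import Data.Bool.Properties using (T-≡; ⇔→≡)
open import Data.Fin using (Fin; toℕ; zero; suc; _≟_)
open import Data.Fin.Properties using (<-cmp)
open import Data.Fin.Subset using (Subset; _─_; _-_; ⋃; _∈_; _∉_; _∪_; ⁅_⁆; _⊆_; ⊥)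
open import Data.Fin.Subset.Properties
  using (∣⊥∣≡0; ∣⁅x⁆∣≡1; ∣p─q∣≤∣p∣; p⊆q⇒∣p∣≤∣q∣; p⊆p∪q; q⊆p∪q; x∈⁅x⁆; x∈p∧x≢y⇒x∈p-y; _∈?_)
open import Data.List using (map; allFin; tabulate)
open import Data.List.Properties using (map-tabulate)
open import Data.Nat using (suc; _+_; _<_; _<ᵇ_; z≤n; s≤s; _≤?_)
open import Data.Nat.Properties hiding (_≟_; <-cmp)
open import Algebra.Properties.Semiring.Sum +-*-semiring
  using (sum; sum-syntax; sum-cong-≗; ∑-comm; ∑-distrib-+; *-distribʳ-sum)
import Data.Nat.ListAction as ListAction
open import Data.Product using (_,_)
open import Data.Vec using ([]; _∷_)
open import Function using (_∘_; _⇔_; mk⇔; Equivalence)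
open import Relation.Binary.Definitions using (tri<; tri≈; tri>)
open import Relation.Binary.PropositionalEquality
open import Relation.Nullary using (yes; no; contradiction)

indicator : Bool → ℕ
indicator b = if b then 1 else 0

sum-mono-≤ : ∀ {n} {f g : Fin n → ℕ} → (∀ i → f i ≤ g i) → sum f ≤ sum g
sum-mono-≤ {ℕ.zero} f≤g = z≤n
sum-mono-≤ {suc n}  f≤g = +-mono-≤ (f≤g zero) (sum-mono-≤ (f≤g ∘ suc))

sum-const : ∀ n c → ∑[ i < n ] c ≡ n * c
sum-const ℕ.zero  c = refl
sum-const (suc n) c = cong (c +_) (sum-const n c)

listSum-map-allFin : ∀ {n} (f : Fin n → ℕ) → ListAction.sum (map f (allFin n)) ≡ sum f
listSum-map-allFin {n} f = trans (cong ListAction.sum (map-tabulate (λ i → i) f)) (listSum-tabulate f)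
  where
  listSum-tabulate : ∀ {n} (f : Fin n → ℕ) → ListAction.sum (tabulate f) ≡ sum f
  listSum-tabulate {ℕ.zero} f = refl
  listSum-tabulate {suc n}  f = cong (f zero +_) (listSum-tabulate (f ∘ suc))

<ᵇ-antisym-indicator : ∀ m n → indicator (m <ᵇ n) + indicator (n <ᵇ m) ≤ 1
<ᵇ-antisym-indicator ℕ.zero  ℕ.zero  = z≤n
<ᵇ-antisym-indicator ℕ.zero  (suc n) = s≤s z≤n
<ᵇ-antisym-indicator (suc m) ℕ.zero  = s≤s z≤n
<ᵇ-antisym-indicator (suc m) (suc n) = <ᵇ-antisym-indicator m n

indicator-∧-≤ : ∀ b c → indicator (b ∧ c) ≤ indicator b
indicator-∧-≤ true  true  = ≤-refl
indicator-∧-≤ true  false = z≤n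
indicator-∧-≤ false c     = z≤n

∣p∪q∣≤∣p∣+∣q∣ : ∀ {m} (p q : Subset m) → ∣ p ∪ q ∣ ≤ ∣ p ∣ + ∣ q ∣
∣p∪q∣≤∣p∣+∣q∣ []          []          = z≤n
∣p∪q∣≤∣p∣+∣q∣ (true ∷ p)  (true ∷ q)  = s≤s (≤-trans (∣p∪q∣≤∣p∣+∣q∣ p q) (+-monoʳ-≤ ∣ p ∣ (n≤1+n _)))
∣p∪q∣≤∣p∣+∣q∣ (true ∷ p)  (false ∷ q) = s≤s (∣p∪q∣≤∣p∣+∣q∣ p q)
∣p∪q∣≤∣p∣+∣q∣ (false ∷ p) (true ∷ q)  = ≤-trans (s≤s (∣p∪q∣≤∣p∣+∣q∣ p q)) (≤-reflexive (sym (+-suc _ _)))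
∣p∪q∣≤∣p∣+∣q∣ (false ∷ p) (false ∷ q) = ∣p∪q∣≤∣p∣+∣q∣ p q

p─r─[q─r]≡p─q─r : ∀ {m} (p q r : Subset m) → (p ─ r) ─ (q ─ r) ≡ (p ─ q) ─ r
p─r─[q─r]≡p─q─r []      []          []          = refl
p─r─[q─r]≡p─q─r (a ∷ p) (b ∷ q)     (true ∷ r)  = cong (false ∷_) (p─r─[q─r]≡p─q─r p q r)
p─r─[q─r]≡p─q─r (a ∷ p) (true ∷ q)  (false ∷ r) = cong (false ∷_) (p─r─[q─r]≡p─q─r p q r)
p─r─[q─r]≡p─q─r (a ∷ p) (false ∷ q) (false ∷ r) = cong (a ∷_) (p─r─[q─r]≡p─q─r p q r)

module _ {m : ℕ} where

  x∉p⇒p⊆p-x : ∀ {p : Subset m} {x} → x ∉ p → p ⊆ p - x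
  x∉p⇒p⊆p-x x∉p y∈p = x∈p∧x≢y⇒x∈p-y y∈p (λ { refl → x∉p y∈p })

  ∣p∣≤1+∣p-x∣ : ∀ (p : Subset m) x → ∣ p ∣ ≤ suc ∣ p - x ∣
  ∣p∣≤1+∣p-x∣ p x = begin
    ∣ p ∣                   ≤⟨ p⊆q⇒∣p∣≤∣q∣ p⊆p-x∪⁅x⁆ ⟩
    ∣ (p - x) ∪ ⁅ x ⁆ ∣     ≤⟨ ∣p∪q∣≤∣p∣+∣q∣ (p - x) ⁅ x ⁆ ⟩
    ∣ p - x ∣ + ∣ ⁅ x ⁆ ∣   ≡⟨ cong (∣ p - x ∣ +_) (∣⁅x⁆∣≡1 x) ⟩
    ∣ p - x ∣ + 1           ≡⟨ +-comm _ 1 ⟩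
    suc ∣ p - x ∣           ∎
    where
    open ≤-Reasoning
    p⊆p-x∪⁅x⁆ : p ⊆ (p - x) ∪ ⁅ x ⁆
    p⊆p-x∪⁅x⁆ {y} y∈p with y ≟ x
    ... | yes refl = q⊆p∪q (p - x) ⁅ x ⁆ (x∈⁅x⁆ x)
    ... | no  y≢x  = p⊆p∪q ⁅ x ⁆ (x∈p∧x≢y⇒x∈p-y y∈p y≢x)

  ⋃ᶠ : ∀ {n} → (Fin n → Subset m) → Subset m
  ⋃ᶠ F = ⋃ (tabulate F)

  ∈⋃ᶠ : ∀ {n} (F : Fin n → Subset m) i {x} → x ∈ F i → x ∈ ⋃ᶠ F
  ∈⋃ᶠ F zero    x∈F = p⊆p∪q _ x∈F
  ∈⋃ᶠ F (suc i) x∈F = q⊆p∪q (F zero) _ (∈⋃ᶠ (F ∘ suc) i x∈F)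

  ∣⋃ᶠ∣≤∑ : ∀ {n} (F : Fin n → Subset m) → ∣ ⋃ᶠ F ∣ ≤ ∑[ i < n ] ∣ F i ∣
  ∣⋃ᶠ∣≤∑ {ℕ.zero} F = ≤-reflexive (∣⊥∣≡0 m)
  ∣⋃ᶠ∣≤∑ {suc n}  F =
    ≤-trans (∣p∪q∣≤∣p∣+∣q∣ (F zero) _) (+-monoʳ-≤ ∣ F zero ∣ (∣⋃ᶠ∣≤∑ (F ∘ suc)))

  critical : ℕ → Subset m → Subset m
  critical k p with ∣ p ∣ ≤? k
  ... | yes _ = p
  ... | no  _ = ⊥

  ∣critical∣≤k : ∀ k p → ∣ critical k p ∣ ≤ k
  ∣critical∣≤k k p with ∣ p ∣ ≤? k
  ... | yes p≤k = p≤k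
  ... | no  _   = ≤-trans (≤-reflexive (∣⊥∣≡0 m)) z≤n

  k≤∣p-x∣ : ∀ {k} p {x} → k ≤ ∣ p ∣ → x ∉ critical k p → k ≤ ∣ p - x ∣
  k≤∣p-x∣ {k} p {x} k≤p x∉crit with ∣ p ∣ ≤? k
  ... | yes _   = ≤-trans k≤p (p⊆q⇒∣p∣≤∣q∣ (x∉p⇒p⊆p-x x∉crit))
  ... | no  p≰k = ≤-pred (≤-trans (≰⇒> p≰k) (∣p∣≤1+∣p-x∣ p x))

module _ {n m : ℕ} where

  deleteElem : Fin m → Family n m → Family n m
  deleteElem x A l = A l - x

  ∣delete─delete∣≡ : ∀ (A : Family n m) x i j →
                     ∣ deleteElem x A i ─ deleteElem x A j ∣ ≡ ∣ (A i ─ A j) - x ∣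
  ∣delete─delete∣≡ A x i j = cong ∣_∣ (p─r─[q─r]≡p─q─r (A i) (A j) ⁅ x ⁆)

  minDiff-delete-≤ : ∀ (A : Family n m) x i j → minDiff (deleteElem x A) i j ≤ minDiff A i j
  minDiff-delete-≤ A x i j = ⊓-mono-≤ (shrinks i j) (shrinks j i)
    where
    shrinks : ∀ i j → ∣ deleteElem x A i ─ deleteElem x A j ∣ ≤ ∣ A i ─ A j ∣
    shrinks i j = subst (_≤ _) (sym (∣delete─delete∣≡ A x i j)) (∣p─q∣≤∣p∣ (A i ─ A j) ⁅ x ⁆)

  k≤minDiff-delete : ∀ {k} (A : Family n m) {x} i j → k ≤ minDiff A i j →
                     x ∉ critical k (A i ─ A j) → x ∉ critical k (A j ─ A i) →
                     k ≤ minDiff (deleteElem x A) i j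
  k≤minDiff-delete {k} A {x} i j k≤min x∉ij x∉ji =
    ⊓-glb (survives i j (m≤n⊓o⇒m≤n _ _ k≤min) x∉ij) (survives j i (m≤n⊓o⇒m≤o _ _ k≤min) x∉ji)
    where
    survives : ∀ i j → k ≤ ∣ A i ─ A j ∣ → x ∉ critical k (A i ─ A j) →
               k ≤ ∣ deleteElem x A i ─ deleteElem x A j ∣
    survives i j k≤ x∉ = subst (k ≤_) (sym (∣delete─delete∣≡ A x i j)) (k≤∣p-x∣ (A i ─ A j) k≤ x∉)

  repAdj≡true⇔ : ∀ k (A : Family n m) i j → (repAdj k A i j ≡ true) ⇔ (k ≤ minDiff A i j)
  repAdj≡true⇔ k A i j =
    mk⇔ (≤ᵇ⇒≤ k _ ∘ Equivalence.from T-≡) (Equivalence.to T-≡ ∘ ≤⇒≤ᵇ)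

module _ {n : ℕ} (G : Graph n) where

  edge< : Fin n → Fin n → Bool
  edge< i j = (toℕ i <ᵇ toℕ j) ∧ adj G i j

  edgeCount≡∑∑ : edgeCount G ≡ ∑[ i < n ] ∑[ j < n ] indicator (edge< i j)
  edgeCount≡∑∑ = trans (listSum-map-allFin (λ i → ListAction.sum (map (λ j → indicator (edge< i j)) (allFin n))))
    (sum-cong-≗ {n} (λ i → listSum-map-allFin (λ j → indicator (edge< i j))))

  edge<-true : ∀ {i j} → toℕ i < toℕ j → adj G i j ≡ true → edge< i j ≡ true
  edge<-true {i} {j} i<j ij∈E rewrite Equivalence.to T-≡ (<⇒<ᵇ i<j) = ij∈E

  twice-edgeCount≤n² : 2 * edgeCount G ≤ n ^ 2
  twice-edgeCount≤n² = begin
    2 * edgeCount G                   ≡⟨ cong (2 *_) edgeCount≡∑∑ ⟩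
    2 * e                             ≡⟨ cong (e +_) (+-identityʳ e) ⟩
    e + e                             ≡⟨ cong (e +_) (∑-comm a) ⟩
    e + ∑[ i < n ] ∑[ j < n ] a j i   ≡⟨ ∑-distrib-+ (λ i → ∑[ j < n ] a i j) _ ⟨
    ∑[ i < n ] (∑[ j < n ] a i j + ∑[ j < n ] a j i)
      ≡⟨ sum-cong-≗ {n} (λ i → ∑-distrib-+ (a i) (λ j → a j i)) ⟨
    ∑[ i < n ] ∑[ j < n ] (a i j + a j i)
      ≤⟨ sum-mono-≤ (λ i → sum-mono-≤ {g = λ _ → 1} (at-most-one-direction i)) ⟩
    ∑[ i < n ] ∑[ j < n ] 1           ≡⟨ trans (sum-cong-≗ {n} (λ _ → sum-const n 1)) (sum-const n (n * 1)) ⟩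
    n ^ 2                             ∎
    where
    open ≤-Reasoning
    a : Fin n → Fin n → ℕ
    a i j = indicator (edge< i j)
    e : ℕ
    e = ∑[ i < n ] ∑[ j < n ] a i j
    at-most-one-direction : ∀ i j → a i j + a j i ≤ 1
    at-most-one-direction i j = ≤-trans
      (+-mono-≤ (indicator-∧-≤ (toℕ i <ᵇ toℕ j) _) (indicator-∧-≤ (toℕ j <ᵇ toℕ i) _))
      (<ᵇ-antisym-indicator (toℕ i) (toℕ j))

  module _ {m : ℕ} (k : ℕ) (A : Family n m) where

    criticalOfEdge : Fin n → Fin n → Subset m
    criticalOfEdge i j =
      if edge< i j then critical k (A i ─ A j) ∪ critical k (A j ─ A i) else ⊥

    criticalSet : Subset m
    criticalSet = ⋃ᶠ (λ i → ⋃ᶠ (λ j → criticalOfEdge i j))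

    ∣criticalOfEdge∣≤ : ∀ i j → ∣ criticalOfEdge i j ∣ ≤ indicator (edge< i j) * (2 * k)
    ∣criticalOfEdge∣≤ i j with edge< i j
    ... | false = ≤-reflexive (∣⊥∣≡0 m)
    ... | true  = begin
      ∣ critical k (A i ─ A j) ∪ critical k (A j ─ A i) ∣   ≤⟨ ∣p∪q∣≤∣p∣+∣q∣ (critical k (A i ─ A j)) (critical k (A j ─ A i)) ⟩
      ∣ critical k (A i ─ A j) ∣ + ∣ critical k (A j ─ A i) ∣
        ≤⟨ +-mono-≤ (∣critical∣≤k k (A i ─ A j)) (∣critical∣≤k k (A j ─ A i)) ⟩
      k + k                                                ≡⟨ cong (k +_) (+-identityʳ k) ⟨
      2 * k                                                ≡⟨ +-identityʳ _ ⟨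
      1 * (2 * k)                                          ∎
      where open ≤-Reasoning

    ∣criticalSet∣≤ : ∣ criticalSet ∣ ≤ 2 * edgeCount G * k
    ∣criticalSet∣≤ = begin
      ∣ criticalSet ∣
        ≤⟨ ∣⋃ᶠ∣≤∑ (λ i → ⋃ᶠ (criticalOfEdge i)) ⟩
      ∑[ i < n ] ∣ ⋃ᶠ (criticalOfEdge i) ∣
        ≤⟨ sum-mono-≤ (λ i → ≤-trans (∣⋃ᶠ∣≤∑ (criticalOfEdge i)) (sum-mono-≤ (∣criticalOfEdge∣≤ i))) ⟩
      ∑[ i < n ] ∑[ j < n ] (indicator (edge< i j) * (2 * k))
        ≡⟨ sum-cong-≗ {n} (λ i → *-distribʳ-sum (2 * k) (λ j → indicator (edge< i j))) ⟨
      ∑[ i < n ] (∑[ j < n ] indicator (edge< i j) * (2 * k))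
        ≡⟨ *-distribʳ-sum (2 * k) (λ i → ∑[ j < n ] indicator (edge< i j)) ⟨
      (∑[ i < n ] ∑[ j < n ] indicator (edge< i j)) * (2 * k)
        ≡⟨ cong (_* (2 * k)) edgeCount≡∑∑ ⟨
      edgeCount G * (2 * k)
        ≡⟨ trans (sym (*-assoc (edgeCount G) 2 k)) (cong (_* k) (*-comm (edgeCount G) 2)) ⟩
      2 * edgeCount G * k              ∎
      where open ≤-Reasoning

    ∉criticalSet⇒∉critical : ∀ {x i j} → x ∉ criticalSet → edge< i j ≡ true →
                             x ∉ critical k (A i ─ A j) × x ∉ critical k (A j ─ A i)
    ∉criticalSet⇒∉critical {x} {i} {j} x∉S ij∈E =
        (λ x∈ → x∉S (inCriticalSet (p⊆p∪q _ x∈)))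
      , (λ x∈ → x∉S (inCriticalSet (q⊆p∪q (critical k (A i ─ A j)) _ x∈)))
      where
      inCriticalSet : x ∈ critical k (A i ─ A j) ∪ critical k (A j ─ A i) → x ∈ criticalSet
      inCriticalSet x∈ = ∈⋃ᶠ _ i (∈⋃ᶠ (criticalOfEdge i) j (subst
        (λ b → x ∈ (if b then critical k (A i ─ A j) ∪ critical k (A j ─ A i) else ⊥))
        (sym ij∈E) x∈))

    delete-preserves-rep : IsMinDiffRep k G A → ∀ {x} → x ∉ criticalSet →
                           ∀ i j → i ≢ j → repAdj k (deleteElem x A) i j ≡ adj G i j
    delete-preserves-rep rep {x} x∉S i j i≢j = ⇔→≡ (mk⇔
      (λ ij∈E′ → Equivalence.from (rep i j i≢j)
        (≤-trans (Equivalence.to (repAdj≡true⇔ k (deleteElem x A) i j) ij∈E′) (minDiff-delete-≤ A x i j)))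
      (λ ij∈E → Equivalence.from (repAdj≡true⇔ k (deleteElem x A) i j)
        (survives ij∈E (Equivalence.to (rep i j i≢j) ij∈E))))
      where
      survives : adj G i j ≡ true → k ≤ minDiff A i j → k ≤ minDiff (deleteElem x A) i j
      survives ij∈E k≤min with <-cmp i j
      ... | tri< i<j _ _ = let x∉ij , x∉ji = ∉criticalSet⇒∉critical x∉S (edge<-true i<j ij∈E)
                           in k≤minDiff-delete A i j k≤min x∉ij x∉ji
      ... | tri≈ _ i≡j _ = contradiction i≡j i≢j
      ... | tri> _ _ j<i = let x∉ji , x∉ij = ∉criticalSet⇒∉critical x∉S
                                               (edge<-true j<i (trans (adj-sym G j i) ij∈E))
                           in k≤minDiff-delete A i j k≤min x∉ij x∉ji

    reduced⇒bigUnion⊆criticalSet : IsMinDiffRep k G A → IsReduced k G A → bigUnion A ⊆ criticalSet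
    reduced⇒bigUnion⊆criticalSet rep red {x} x∈⋃ with x ∈? criticalSet
    ... | yes x∈S = x∈S
    ... | no  x∉S = contradiction (delete-preserves-rep rep x∉S) (red x x∈⋃)

lemma4 : ∀ (n m k : ℕ) → 1 ≤ k → (G : Graph n) → (A : Family n m) → IsMinDiffRep k G A → IsReduced k G A
    → (∣ bigUnion A ∣ ≤ 2 * edgeCount G * k) × (2 * edgeCount G * k ≤ k * n ^ 2)
lemma4 n m k _ G A rep red =
    ≤-trans (p⊆q⇒∣p∣≤∣q∣ (reduced⇒bigUnion⊆criticalSet G k A rep red)) (∣criticalSet∣≤ G k A)
  , (begin
      2 * edgeCount G * k    ≡⟨ *-comm _ k ⟩
      k * (2 * edgeCount G)  ≤⟨ *-monoʳ-≤ k (twice-edgeCount≤n² G) ⟩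
      k * n ^ 2              ∎)
  where open ≤-Reasoning
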